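{- Let $M=\{1^{p_1},\dots,n^{p_n}\}$ be a multiset with $p_1,\dots,p_n$ positive integers. Then $$\sum_{T\in\mathcal{T}_M}\#\{\text{nodes of } T \text{ with odd full-degree}\}=2\sum_{T\in\mathcal{T}_M}\#\{\text{nodes of } T\text{ with odd degree}\}.$$
   Context: A plane tree is a rooted tree in which the children of every node are linearly ordered. With $p=\sum p_i$, a weakly increasing tree on $M$ is a plane tree with $p+1$ nodes labeled by the elements of the multiset $M\cup\{0\}$ (with multiplicity) such that labels weakly increase along every root-to-leaf path and the labels of the children of each node weakly increase from left to right. $\mathcal{T}_M$ is the set of such trees. The degree of a node is its number of children. The full-degree of a node $v$ is the number of nodes adjacent to $v$ (i.e., its degree plus one, unless $v$ is the root, in which case it equals its degree). -}

module Defs where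

open import Data.Nat using (ℕ; zero; suc; _+_; _≤_)
open import Data.Bool using (Bool; true; false; if_then_else_)
open import Data.Fin using (Fin; toℕ)
open import Data.List using (List; []; _∷_; map; length; concat; replicate; allFin)
open import Data.List.Relation.Unary.All using (All)
open import Data.List.Relation.Unary.Linked using (Linked)
open import Data.List.Relation.Binary.Permutation.Propositional using (_↭_)

data Tree : Set where
  node : ℕ → List Tree → Tree

label : Tree → ℕ
label (node a _) = a

-- Labels of all nodes (preorder), as a list (= multiset up to permutation).
mutual
  labels : Tree → List ℕ
  labels (node a cs) = a ∷ labelsF cs

  labelsF : List Tree → List ℕ
  labelsF [] = []
  labelsF (t ∷ ts) = labels t Data.List.++ labelsF ts

data WeaklyIncreasing : Tree → Set where
  wnode : ∀ {a cs} →
          All (λ c → a ≤ label c) cs →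
          Linked _≤_ (map label cs) →
          All WeaklyIncreasing cs →
          WeaklyIncreasing (node a cs)

multisetList : (n : ℕ) → (Fin n → ℕ) → List ℕ
multisetList n p = concat (map (λ i → replicate (p i) (suc (toℕ i))) (allFin n))

InTM : (n : ℕ) → (Fin n → ℕ) → Tree → Set
InTM n p T = WeaklyIncreasing T × (labels T ↭ (0 ∷ multisetList n p))
  where open import Data.Product using (_×_)

odd : ℕ → Bool
odd zero = false
odd (suc k) = if odd k then false else true

b2n : Bool → ℕ
b2n true = 1
b2n false = 0

mutual
  oddDegreeNodes : Tree → ℕ
  oddDegreeNodes (node _ cs) = b2n (odd (length cs)) + oddDegreeNodesF cs

  oddDegreeNodesF : List Tree → ℕ
  oddDegreeNodesF [] = 0
  oddDegreeNodesF (t ∷ ts) = oddDegreeNodes t + oddDegreeNodesF ts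

-- Number of nodes with odd full-degree, in a subtree whose root is NOT the
-- root of the whole tree (so every node's full-degree is degree + 1).
mutual
  oddFullDegreeNonRoot : Tree → ℕ
  oddFullDegreeNonRoot (node _ cs) = b2n (odd (suc (length cs))) + oddFullDegreeNonRootF cs

  oddFullDegreeNonRootF : List Tree → ℕ
  oddFullDegreeNonRootF [] = 0
  oddFullDegreeNonRootF (t ∷ ts) = oddFullDegreeNonRoot t + oddFullDegreeNonRootF ts

-- Number of nodes of T with odd full-degree (root: full-degree = degree).
oddFullDegreeNodes : Tree → ℕ
oddFullDegreeNodes (node _ cs) = b2n (odd (length cs)) + oddFullDegreeNonRootF cs

-- Call surplus a b = a − 2 b, and the defect of a tree the surplus of its number of nodes of odd
-- full-degree over its number of nodes of odd degree. The defect is a sum over nodes: a non-root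
-- node of degree d contributes odd (d + 1) − 2 odd d = 1 − 3 odd d, and the root − odd d.
-- The defect sums to zero over the more general class of groves: sequences of forests F₁ … F_k,
-- where Fᵢ hangs below a root labelled bᵢ, all weakly increasing, and the non-root labels form a
-- given multiset; the trees of 𝒯_M are the groves below the single root 0. Either the first
-- forest is empty and can be dropped, or it starts with a tree of root label c and children G,
-- followed by siblings F. Cutting off that root leaves the grove G, F, … below the roots c, c, …
-- with one label fewer (so induction applies), and changes the defect by the parity imbalance
-- 2 (odd |F| − odd |G|), which sums to zero because exchanging G and F is an involution of that
-- class.
module Submission where

open import Defs
open import Data.Nat using (ℕ; _<_; _*_)
open import Data.Fin using (Fin)
open import Data.List using (List; map)
open import Data.Nat.ListAction using (sum)
open import Data.List.Membership.Propositional using (_∈_)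
open import Data.List.Relation.Unary.Unique.Propositional using (Unique)
open import Function.Bundles using (_⇔_)
open import Relation.Binary.PropositionalEquality using (_≡_)

open import Data.Bool using (true; false)
open import Data.Empty using (⊥-elim)
open import Data.Sum using (inj₁; inj₂)
open import Data.Nat as ℕ using (suc; _≤_; _≤?_; z≤n; s≤s)
open import Data.Integer as ℤ using (ℤ; +_; 0ℤ; 1ℤ; _+_; _-_; -_)
import Data.Integer.Properties as ℤP
open import Data.Integer.Tactic.RingSolver using (solve-∀)
open import Data.List using ([]; _∷_; _++_; foldr; filter; length; drop; concatMap)
open import Data.List.Properties using (map-∘; map-cong-local; ++-assoc; ++-identityʳ)
open import Data.List.Membership.Propositional.Properties
  using (∈-map⁺; ∈-map⁻; ∈-filter⁺; ∈-filter⁻; ∈-∃++; ∈-++⁻)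
open import Data.List.Membership.Propositional.Properties.WithK using (unique∧set⇒bag)
open import Data.List.Membership.DecPropositional ℕ._≟_ using (_∈?_)
open import Data.List.Relation.Binary.BagAndSetEquality using (∼bag⇒↭)
open import Data.List.Relation.Binary.Permutation.Propositional
  using (_↭_; ↭-sym; ↭-trans; ↭-reflexive; prep; ↭⇒↭ₛ)
open import Data.List.Relation.Binary.Permutation.Propositional.Properties
  using (↭-length; drop-∷; ∈-resp-↭; shift; shifts)
import Data.List.Relation.Binary.Permutation.Propositional.Properties as ↭
open import Data.List.Relation.Binary.Pointwise using (Pointwise; []; _∷_)
open import Data.List.Relation.Unary.All as All using (All; []; _∷_)
import Data.List.Relation.Unary.All.Properties as AllP
open import Data.List.Relation.Unary.AllPairs using ([]; _∷_)
open import Data.List.Relation.Unary.Any using (here; there)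
open import Data.List.Relation.Unary.Linked as Linked using (Linked; []; [-]; _∷_)
open import Data.List.Relation.Unary.Linked.Properties using (Linked⇒All)
import Data.List.Relation.Unary.Unique.Propositional.Properties as UniqueP
import Data.Nat.Properties as ℕP
open import Data.Nat.Induction using (<-rec)
open import Data.Product using (Σ; _×_; _,_; proj₁; proj₂; ∃)
open import Function using (_∘_; case_of_)
open import Function.Bundles using (mk⇔; Equivalence)
open import Relation.Binary.PropositionalEquality
  using (refl; sym; trans; cong; cong₂; setoid; module ≡-Reasoning)
open import Relation.Nullary using (yes; no; _×-dec_)
open import Relation.Unary using (Decidable; _∩_; ∁)
open import Relation.Unary.Properties using (∁?)
open import Algebra.Properties.CommutativeSemigroup ℤP.+-commutativeSemigroup
  using (interchange; x∙yz≈y∙xz)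
open Equivalence using (to; from)

sumℤ : List ℤ → ℤ
sumℤ = foldr _+_ 0ℤ

sumℤ-↭ : {xs ys : List ℤ} → xs ↭ ys → sumℤ xs ≡ sumℤ ys
sumℤ-↭ xs↭ys = foldr-commMonoid ℤP.+-0-isCommutativeMonoid (↭⇒↭ₛ xs↭ys)
  where
  open import Data.List.Relation.Binary.Permutation.Setoid.Properties (setoid ℤ)
    using (foldr-commMonoid)

i+i≡0⇒i≡0 : ∀ i → i + i ≡ 0ℤ → i ≡ 0ℤ
i+i≡0⇒i≡0 (+ 0) _ = refl

∈⇒≤sum : ∀ {n ns} → n ∈ ns → n ≤ sum ns
∈⇒≤sum {ns = m ∷ ms} (here refl) = ℕP.m≤m+n m (sum ms)
∈⇒≤sum {ns = m ∷ ms} (there n∈ms) = ℕP.≤-trans (∈⇒≤sum n∈ms) (ℕP.m≤n+m (sum ms) m)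

∈⇒↭∷ : ∀ {A : Set} {x : A} {xs} → x ∈ xs → ∃ λ ys → xs ↭ x ∷ ys
∈⇒↭∷ x∈xs with ys , zs , refl ← ∈-∃++ x∈xs = ys ++ zs , shift _ ys zs

module _ {A : Set} where

  Enumerates : (A → Set) → List A → Set
  Enumerates P xs = Unique xs × (∀ x → x ∈ xs ⇔ P x)

  -- No finiteness of P is assumed; an unenumerable P satisfies ZeroSum vacuously.
  ZeroSum : (A → ℤ) → (A → Set) → Set
  ZeroSum h P = ∀ xs → Enumerates P xs → sumℤ (map h xs) ≡ 0ℤ

  enumerations-↭ : ∀ {P xs ys} → Enumerates P xs → Enumerates P ys → xs ↭ ys
  enumerations-↭ (xs! , xs⇔P) (ys! , ys⇔P) =
    ∼bag⇒↭ (unique∧set⇒bag xs! ys! λ {x} →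
      mk⇔ (from (ys⇔P x) ∘ to (xs⇔P x)) (from (xs⇔P x) ∘ to (ys⇔P x)))

  enumerates-filter : ∀ {P} {Q : A → Set} {xs} (Q? : Decidable Q) →
    Enumerates P xs → Enumerates (P ∩ Q) (filter Q? xs)
  enumerates-filter Q? (xs! , xs⇔P) = UniqueP.filter⁺ Q? xs! , λ x → mk⇔
    (λ x∈ → let x∈xs , q = ∈-filter⁻ Q? x∈ in to (xs⇔P x) x∈xs , q)
    (λ (p , q) → ∈-filter⁺ Q? (from (xs⇔P x) p) q)

  sumℤ-vanishing : ∀ {h : A → ℤ} xs → All (λ x → h x ≡ 0ℤ) xs → sumℤ (map h xs) ≡ 0ℤ
  sumℤ-vanishing [] [] = refl
  sumℤ-vanishing (_ ∷ xs) (hx≡0 ∷ hxs≡0) = cong₂ _+_ hx≡0 (sumℤ-vanishing xs hxs≡0)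

  sumℤ-map-+ : ∀ (f g : A → ℤ) xs →
    sumℤ (map (λ x → f x + g x) xs) ≡ sumℤ (map f xs) + sumℤ (map g xs)
  sumℤ-map-+ f g [] = refl
  sumℤ-map-+ f g (x ∷ xs) =
    trans (cong (_+_ (f x + g x)) (sumℤ-map-+ f g xs)) (interchange (f x) (g x) _ _)

  sumℤ-filter : ∀ (h : A → ℤ) {Q : A → Set} (Q? : Decidable Q) xs →
    sumℤ (map h xs) ≡ sumℤ (map h (filter Q? xs)) + sumℤ (map h (filter (∁? Q?) xs))
  sumℤ-filter h Q? [] = refl
  sumℤ-filter h Q? (x ∷ xs) with Q? x
  ... | yes _ = trans (cong (_+_ (h x)) (sumℤ-filter h Q? xs)) (sym (ℤP.+-assoc (h x) _ _))
  ... | no _ = trans (cong (_+_ (h x)) (sumℤ-filter h Q? xs))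
    (x∙yz≈y∙xz (h x) (sumℤ (map h (filter Q? xs))) (sumℤ (map h (filter (∁? Q?) xs))))

  zeroSum-vanishing : ∀ {h P} → (∀ {x} → P x → h x ≡ 0ℤ) → ZeroSum h P
  zeroSum-vanishing h≡0 xs (_ , xs⇔P) =
    sumℤ-vanishing xs (All.tabulate (h≡0 ∘ to (xs⇔P _)))

  zeroSum-cong : ∀ {f g P} → (∀ {x} → P x → f x ≡ g x) → ZeroSum f P → ZeroSum g P
  zeroSum-cong f≡g zero xs enum@(_ , xs⇔P) =
    trans (cong sumℤ (sym (map-cong-local (All.tabulate (f≡g ∘ to (xs⇔P _)))))) (zero xs enum)

  zeroSum-+ : ∀ {f g P} → ZeroSum f P → ZeroSum g P → ZeroSum (λ x → f x + g x) P
  zeroSum-+ {f} {g} zero-f zero-g xs enum =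
    trans (sumℤ-map-+ f g xs) (cong₂ _+_ (zero-f xs enum) (zero-g xs enum))

  zeroSum-resp : ∀ {h P Q} → (∀ {x} → P x → Q x) → (∀ {x} → Q x → P x) →
    ZeroSum h Q → ZeroSum h P
  zeroSum-resp P⇒Q Q⇒P zero xs (xs! , xs⇔P) =
    zero xs (xs! , λ x → mk⇔ (P⇒Q ∘ to (xs⇔P x)) (from (xs⇔P x) ∘ Q⇒P))

  zeroSum-split : ∀ {h P} {Q : A → Set} (Q? : Decidable Q) →
    ZeroSum h (P ∩ Q) → ZeroSum h (P ∩ ∁ Q) → ZeroSum h P
  zeroSum-split {h} Q? zero-Q zero-∁Q xs enum = trans (sumℤ-filter h Q? xs)
    (cong₂ _+_ (zero-Q _ (enumerates-filter Q? enum)) (zero-∁Q _ (enumerates-filter (∁? Q?) enum)))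

  zeroSum-byKey : ∀ {h P} (key : A → ℕ) (K : ℕ) → (∀ {x} → P x → key x < K) →
    (∀ k → ZeroSum h (λ x → P x × key x ≡ k)) → ZeroSum h P
  zeroSum-byKey {h} {P} key K key<K zero-k = zeroSum-resp (λ p → p , key<K p) proj₁ (below K)
    where
    below : ∀ k → ZeroSum h (λ x → P x × key x < k)
    below 0 = zeroSum-vanishing (λ ())
    below (suc k) = zeroSum-split (λ x → key x ℕ.≟ k)
      (zeroSum-resp (λ ((p , _) , ≡k) → p , ≡k)
                    (λ (p , ≡k) → (p , ℕP.≤-reflexive (cong suc ≡k)) , ≡k)
                    (zero-k k))
      (zeroSum-resp (λ ((p , <1+k) , ≢k) → p , ℕP.≤∧≢⇒< (ℕ.s≤s⁻¹ <1+k) ≢k)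
                    (λ (p , <k) → (p , ℕP.m<n⇒m<1+n <k) , λ ≡k → ℕP.<-irrefl ≡k <k)
                    (below k))

module _ {A B : Set} where

  record BijectiveOn (f : A → B) (P : A → Set) (Q : B → Set) : Set where
    field
      mapsTo : ∀ {x} → P x → Q (f x)
      injective : ∀ {x y} → P x → P y → f x ≡ f y → x ≡ y
      surjective : ∀ {y} → Q y → Σ A λ x → P x × f x ≡ y

  unique-map : ∀ {f : A → B} {P : A → Set} {xs} →
    (∀ {x y} → P x → P y → f x ≡ f y → x ≡ y) → All P xs → Unique xs → Unique (map f xs)
  unique-map inj [] [] = []
  unique-map inj (px ∷ pxs) (x∉xs ∷ xs!) =
    AllP.map⁺ (All.zipWith (λ (x≢y , py) fx≡fy → x≢y (inj px py fx≡fy)) (x∉xs , pxs))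
      ∷ unique-map inj pxs xs!

  enumerates-map : ∀ {f P Q xs} → BijectiveOn f P Q → Enumerates P xs → Enumerates Q (map f xs)
  enumerates-map {f} {P} {Q} {xs} bij (xs! , xs⇔P) =
    unique-map injective (All.tabulate (to (xs⇔P _))) xs! , λ y → mk⇔ (into y) (onto y)
    where
    open BijectiveOn bij
    into : ∀ y → y ∈ map f xs → Q y
    into y y∈ with x , x∈xs , refl ← ∈-map⁻ f y∈ = mapsTo (to (xs⇔P x) x∈xs)
    onto : ∀ y → Q y → y ∈ map f xs
    onto y q with x , p , refl ← surjective q = ∈-map⁺ f (from (xs⇔P x) p)

  zeroSum-∘ : ∀ {f g P Q} → BijectiveOn f P Q → ZeroSum g Q → ZeroSum (g ∘ f) P
  zeroSum-∘ bij zero xs enum = trans (cong sumℤ (map-∘ xs)) (zero _ (enumerates-map bij enum))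

module _ {A : Set} where

  zeroSum-antisymmetric : ∀ {h : A → ℤ} {P} (σ : A → A) → (∀ x → σ (σ x) ≡ x) →
    (∀ {x} → P x → P (σ x)) → (∀ x → h (σ x) ≡ - h x) → ZeroSum h P
  zeroSum-antisymmetric {h} {P} σ σσ≡id σ-closed h∘σ≡-h xs enum = i+i≡0⇒i≡0 S (begin
    S + S                                ≡⟨ cong (_+_ S) (sumℤ-↭ (↭.map⁺ h xs↭σxs)) ⟩
    S + sumℤ (map h (map σ xs))          ≡⟨ cong (λ ys → S + sumℤ ys) (map-∘ xs) ⟨
    S + sumℤ (map (h ∘ σ) xs)            ≡⟨ sumℤ-map-+ h (h ∘ σ) xs ⟨
    sumℤ (map (λ x → h x + h (σ x)) xs)  ≡⟨ sumℤ-vanishing xs (All.universal cancel xs) ⟩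
    0ℤ                                   ∎)
    where
    open ≡-Reasoning
    S : ℤ
    S = sumℤ (map h xs)
    σ-bijective : BijectiveOn σ P P
    σ-bijective = record
      { mapsTo = σ-closed
      ; injective = λ {x} {y} _ _ σx≡σy →
          trans (sym (σσ≡id x)) (trans (cong σ σx≡σy) (σσ≡id y))
      ; surjective = λ {y} p → σ y , σ-closed p , σσ≡id y }
    xs↭σxs : xs ↭ map σ xs
    xs↭σxs = enumerations-↭ enum (enumerates-map σ-bijective enum)
    cancel : ∀ x → h x + h (σ x) ≡ 0ℤ
    cancel x = trans (cong (_+_ (h x)) (h∘σ≡-h x)) (ℤP.+-inverseʳ (h x))

surplus : ℕ → ℕ → ℤ
surplus a b = + a - + 2 ℤ.* + b

surplus-+ : ∀ a b c d → surplus (a ℕ.+ b) (c ℕ.+ d) ≡ surplus a c + surplus b d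
surplus-+ a b c d = trans (cong₂ (λ i j → i - + 2 ℤ.* j) (ℤP.pos-+ a b) (ℤP.pos-+ c d))
                          (regroup (+ a) (+ b) (+ c) (+ d))
  where
  regroup : ∀ i j k l → (i + j) - + 2 ℤ.* (k + l) ≡ (i - + 2 ℤ.* k) + (j - + 2 ℤ.* l)
  regroup = solve-∀

surplus≡0⇒a≡2*b : ∀ a b → surplus a b ≡ 0ℤ → a ≡ 2 * b
surplus≡0⇒a≡2*b a b a-2b≡0 =
  ℤP.+-injective (trans (ℤP.i-j≡0⇒i≡j _ _ a-2b≡0) (sym (ℤP.pos-* 2 b)))

sumℤ-surplus : ∀ {A : Set} (f g : A → ℕ) xs →
  sumℤ (map (λ x → surplus (f x) (g x)) xs) ≡ surplus (sum (map f xs)) (sum (map g xs))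
sumℤ-surplus f g [] = refl
sumℤ-surplus f g (x ∷ xs) =
  trans (cong (_+_ (surplus (f x) (g x))) (sumℤ-surplus f g xs))
        (sym (surplus-+ (f x) (sum (map f xs)) (g x) (sum (map g xs))))

oddℤ : ℕ → ℤ
oddℤ k = + b2n (odd k)

oddℤ-suc : ∀ k → oddℤ (suc k) ≡ 1ℤ - oddℤ k
oddℤ-suc k with odd k
... | true = refl
... | false = refl

surplus-odd-suc : ∀ k → surplus (b2n (odd (suc k))) (b2n (odd k)) ≡ 1ℤ - + 3 ℤ.* oddℤ k
surplus-odd-suc k with odd k
... | true = refl
... | false = refl

surplus-diagonal : ∀ k → surplus k k ≡ - + k
surplus-diagonal k = i-2i≡-i (+ k)
  where
  i-2i≡-i : ∀ i → i - + 2 ℤ.* i ≡ - i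
  i-2i≡-i = solve-∀

mutual
  subtreeDefect : Tree → ℤ
  subtreeDefect (node _ cs) = (1ℤ - + 3 ℤ.* oddℤ (length cs)) + forestDefect cs

  forestDefect : List Tree → ℤ
  forestDefect [] = 0ℤ
  forestDefect (t ∷ ts) = subtreeDefect t + forestDefect ts

rootedDefect : List Tree → ℤ
rootedDefect cs = - oddℤ (length cs) + forestDefect cs

mutual
  subtreeDefect-surplus : ∀ t →
    surplus (oddFullDegreeNonRoot t) (oddDegreeNodes t) ≡ subtreeDefect t
  subtreeDefect-surplus (node _ cs) =
    trans (surplus-+ (b2n (odd (suc (length cs)))) _ (b2n (odd (length cs))) _)
          (cong₂ _+_ (surplus-odd-suc (length cs)) (forestDefect-surplus cs))

  forestDefect-surplus : ∀ ts →
    surplus (oddFullDegreeNonRootF ts) (oddDegreeNodesF ts) ≡ forestDefect ts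
  forestDefect-surplus [] = refl
  forestDefect-surplus (t ∷ ts) =
    trans (surplus-+ (oddFullDegreeNonRoot t) _ (oddDegreeNodes t) _)
          (cong₂ _+_ (subtreeDefect-surplus t) (forestDefect-surplus ts))

defect : Tree → ℤ
defect T = surplus (oddFullDegreeNodes T) (oddDegreeNodes T)

defect-node : ∀ a cs → defect (node a cs) ≡ rootedDefect cs
defect-node a cs =
  trans (surplus-+ (b2n (odd (length cs))) _ (b2n (odd (length cs))) _)
        (cong₂ _+_ (surplus-diagonal (b2n (odd (length cs)))) (forestDefect-surplus cs))

linked-cons : ∀ {c} ts → All (λ t → c ≤ label t) ts → Linked _≤_ (map label ts) →
  Linked _≤_ (c ∷ map label ts)
linked-cons [] _ _ = [-]
linked-cons (_ ∷ _) (c≤t ∷ _) ts↗ = c≤t ∷ ts↗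

linked-head : ∀ {c} ts → Linked _≤_ (c ∷ map label ts) → All (λ t → c ≤ label t) ts
linked-head [] _ = []
linked-head (_ ∷ _) (c≤t ∷ ts↗) = AllP.map⁻ (Linked⇒All ℕP.≤-trans c≤t ts↗)

wi-graft : ∀ {b c G F} → b ≤ c → WeaklyIncreasing (node b (node c G ∷ F)) ⇔
  (WeaklyIncreasing (node c G) × WeaklyIncreasing (node c F))
wi-graft {b} {c} {G} {F} b≤c = mk⇔ detach attach
  where
  detach : WeaklyIncreasing (node b (node c G ∷ F)) →
    WeaklyIncreasing (node c G) × WeaklyIncreasing (node c F)
  detach (wnode _ c∷F↗ (wiG ∷ wiF)) = wiG , wnode (linked-head F c∷F↗) (Linked.tail c∷F↗) wiF
  attach : WeaklyIncreasing (node c G) × WeaklyIncreasing (node c F) →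
    WeaklyIncreasing (node b (node c G ∷ F))
  attach (wiG , wnode c≤F F↗ wiF) =
    wnode (b≤c ∷ All.map (ℕP.≤-trans b≤c) c≤F) (linked-cons F c≤F F↗) (wiG ∷ wiF)

Grove : List ℕ → List ℕ → List (List Tree) → Set
Grove roots M s =
  Pointwise (λ b F → WeaklyIncreasing (node b F)) roots s × concatMap labelsF s ↭ M

groveDefect : List (List Tree) → ℤ
groveDefect s = sumℤ (map rootedDefect s)

headKey : List (List Tree) → ℕ
headKey ((t ∷ _) ∷ _) = suc (label t)
headKey _ = 0

GroveWithKey : List ℕ → List ℕ → ℕ → List (List Tree) → Set
GroveWithKey roots M k s = Grove roots M s × headKey s ≡ k

detachFirstTree : List (List Tree) → List (List Tree)
detachFirstTree ((node _ G ∷ F) ∷ s) = G ∷ F ∷ s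
detachFirstTree s = s

swapFirstTwo : List (List Tree) → List (List Tree)
swapFirstTwo (G ∷ F ∷ s) = F ∷ G ∷ s
swapFirstTwo s = s

swapFirstTwo-involutive : ∀ s → swapFirstTwo (swapFirstTwo s) ≡ s
swapFirstTwo-involutive [] = refl
swapFirstTwo-involutive (_ ∷ []) = refl
swapFirstTwo-involutive (_ ∷ _ ∷ _) = refl

parityImbalance : List (List Tree) → ℤ
parityImbalance (G ∷ F ∷ _) = + 2 ℤ.* (oddℤ (length F) - oddℤ (length G))
parityImbalance _ = 0ℤ

parityImbalance-swap : ∀ s → parityImbalance (swapFirstTwo s) ≡ - parityImbalance s
parityImbalance-swap [] = refl
parityImbalance-swap (_ ∷ []) = refl
parityImbalance-swap (G ∷ F ∷ _) = antisym (oddℤ (length F)) (oddℤ (length G))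
  where
  antisym : ∀ i j → + 2 ℤ.* (j - i) ≡ - (+ 2 ℤ.* (i - j))
  antisym = solve-∀

groveDefect-detach : ∀ a G F s →
  groveDefect ((node a G ∷ F) ∷ s) ≡ groveDefect (G ∷ F ∷ s) + parityImbalance (G ∷ F ∷ s)
groveDefect-detach a G F s rewrite oddℤ-suc (length F) =
  regroup (oddℤ (length G)) (forestDefect G) (oddℤ (length F)) (forestDefect F) (groveDefect s)
  where
  regroup : ∀ oG dG oF dF d →
    (- (1ℤ - oF) + (((1ℤ - + 3 ℤ.* oG) + dG) + dF)) + d
      ≡ ((- oG + dG) + ((- oF + dF) + d)) + + 2 ℤ.* (oF - oG)
  regroup = solve-∀

labels-detach : ∀ c G F s →
  concatMap labelsF ((node c G ∷ F) ∷ s) ≡ c ∷ concatMap labelsF (G ∷ F ∷ s)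
labels-detach c G F s = cong (c ∷_) (++-assoc (labelsF G) (labelsF F) (concatMap labelsF s))

grove-swap : ∀ {c bs M s} → Grove (c ∷ c ∷ bs) M s → Grove (c ∷ c ∷ bs) M (swapFirstTwo s)
grove-swap {s = G ∷ F ∷ _} (wiG ∷ wiF ∷ wis , labels↭M) =
  wiF ∷ wiG ∷ wis , ↭-trans (shifts (labelsF F) (labelsF G)) labels↭M

headKey-root : ∀ {b bs M s c} → GroveWithKey (b ∷ bs) M (suc c) s → b ≤ c × c ∈ M
headKey-root {s = (node _ _ ∷ _) ∷ _} ((wnode (b≤c ∷ _) _ _ ∷ _ , labels↭M) , refl) =
  b≤c , ∈-resp-↭ labels↭M (here refl)

headKey-bound : ∀ {b bs M s} → Grove (b ∷ bs) M s → headKey s < 2 ℕ.+ sum M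
headKey-bound {s = s} grove with headKey s in key≡
... | 0 = s≤s z≤n
... | suc c = s≤s (s≤s (∈⇒≤sum (proj₂ (headKey-root (grove , key≡)))))

zeroSum-dropEmpty : ∀ {b bs M} → ZeroSum groveDefect (Grove bs M) →
  ZeroSum groveDefect (GroveWithKey (b ∷ bs) M 0)
zeroSum-dropEmpty {b} {bs} {M} zero = zeroSum-cong defect-drop (zeroSum-∘ drop-bijective zero)
  where
  drop-bijective : BijectiveOn (drop 1) (GroveWithKey (b ∷ bs) M 0) (Grove bs M)
  drop-bijective = record
    { mapsTo = λ { {[] ∷ _} ((_ ∷ wis , labels↭M) , _) → wis , labels↭M }
    ; injective = λ { {[] ∷ _} {[] ∷ _} _ _ refl → refl }
    ; surjective = λ { {s} (wis , labels↭M) →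
        [] ∷ s , ((wnode [] [] [] ∷ wis , labels↭M) , refl) , refl } }
  defect-drop : ∀ {s} → GroveWithKey (b ∷ bs) M 0 s → groveDefect (drop 1 s) ≡ groveDefect s
  defect-drop {[] ∷ s} _ = sym (ℤP.+-identityˡ (groveDefect s))

zeroSum-detach : ∀ {b bs M M′ c} → b ≤ c → M ↭ c ∷ M′ →
  ZeroSum groveDefect (Grove (c ∷ c ∷ bs) M′) →
  ZeroSum groveDefect (GroveWithKey (b ∷ bs) M (suc c))
zeroSum-detach {b} {bs} {M} {M′} {c} b≤c M↭ zero = zeroSum-cong defect-detach
  (zeroSum-+ (zeroSum-∘ detach-bijective zero)
             (zeroSum-∘ detach-bijective (zeroSum-antisymmetric
               swapFirstTwo swapFirstTwo-involutive grove-swap parityImbalance-swap)))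
  where
  detach-bijective :
    BijectiveOn detachFirstTree (GroveWithKey (b ∷ bs) M (suc c)) (Grove (c ∷ c ∷ bs) M′)
  detach-bijective = record
    { mapsTo = λ { {(node _ G ∷ F) ∷ s} ((wi ∷ wis , labels↭M) , refl) →
        let wiG , wiF = to (wi-graft b≤c) wi in
        wiG ∷ wiF ∷ wis ,
        drop-∷ (↭-trans (↭-reflexive (sym (labels-detach c G F s))) (↭-trans labels↭M M↭)) }
    ; injective = λ { {(node _ _ ∷ _) ∷ _} {(node _ _ ∷ _) ∷ _} (_ , refl) (_ , refl) refl → refl }
    ; surjective = λ { {G ∷ F ∷ s} (wiG ∷ wiF ∷ wis , labels↭M′) →
        (node c G ∷ F) ∷ s ,
        ((from (wi-graft b≤c) (wiG , wiF) ∷ wis ,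
          ↭-trans (↭-reflexive (labels-detach c G F s)) (↭-trans (prep c labels↭M′) (↭-sym M↭))) ,
         refl) ,
        refl } }
  defect-detach : ∀ {s} → GroveWithKey (b ∷ bs) M (suc c) s →
    groveDefect (detachFirstTree s) + parityImbalance (detachFirstTree s) ≡ groveDefect s
  defect-detach {(node a G ∷ F) ∷ s} _ = sym (groveDefect-detach a G F s)

zeroSum-grove : ∀ roots M → ZeroSum groveDefect (Grove roots M)
zeroSum-grove roots M = <-rec Goal step (length M) roots M refl
  where
  Goal : ℕ → Set
  Goal m = ∀ roots M → length M ≡ m → ZeroSum groveDefect (Grove roots M)
  step : ∀ m → (∀ {m′} → m′ < m → Goal m′) → Goal m
  step _ ih [] M _ = zeroSum-vanishing λ { ([] , _) → refl }
  step _ ih (b ∷ bs) M refl = zeroSum-byKey headKey (2 ℕ.+ sum M) headKey-bound byKey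
    where
    byKey : ∀ k → ZeroSum groveDefect (GroveWithKey (b ∷ bs) M k)
    byKey 0 = zeroSum-dropEmpty (step (length M) ih bs M refl)
    byKey (suc c) with b ≤? c ×-dec c ∈? M
    ... | no ¬root = zeroSum-vanishing (⊥-elim ∘ ¬root ∘ headKey-root)
    ... | yes (b≤c , c∈M) with M′ , M↭ ← ∈⇒↭∷ c∈M =
      zeroSum-detach b≤c M↭ (ih (ℕP.≤-reflexive (sym (↭-length M↭))) (c ∷ c ∷ bs) M′ refl)

mutual
  label≤labels : ∀ {t x} → WeaklyIncreasing t → x ∈ labels t → label t ≤ x
  label≤labels (wnode _ _ _) (here refl) = ℕP.≤-refl
  label≤labels (wnode a≤ts _ wits) (there x∈) = label≤labelsF a≤ts wits x∈

  label≤labelsF : ∀ {a ts x} → All (λ t → a ≤ label t) ts → All WeaklyIncreasing ts →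
    x ∈ labelsF ts → a ≤ x
  label≤labelsF {ts = t ∷ ts} (a≤t ∷ a≤ts) (wit ∷ wits) x∈ with ∈-++⁻ (labels t) x∈
  ... | inj₁ x∈t = ℕP.≤-trans a≤t (label≤labels wit x∈t)
  ... | inj₂ x∈ts = label≤labelsF a≤ts wits x∈ts

TreesOf : List ℕ → Tree → Set
TreesOf M T = WeaklyIncreasing T × labels T ↭ 0 ∷ M

root≡0 : ∀ {M T} → TreesOf M T → label T ≡ 0
root≡0 (wi , labels↭) = ℕP.n≤0⇒n≡0 (label≤labels wi (∈-resp-↭ (↭-sym labels↭) (here refl)))

children : Tree → List Tree
children (node _ cs) = cs

zeroSum-trees : ∀ M → ZeroSum defect (TreesOf M)
zeroSum-trees M =
  zeroSum-cong defect-children (zeroSum-∘ children-bijective (zeroSum-grove (0 ∷ []) M))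
  where
  children-bijective : BijectiveOn (λ T → children T ∷ []) (TreesOf M) (Grove (0 ∷ []) M)
  children-bijective = record
    { mapsTo = λ { {node _ cs} T∈ → case root≡0 T∈ of λ { refl →
        proj₁ T∈ ∷ [] , ↭-trans (↭-reflexive (++-identityʳ (labelsF cs))) (drop-∷ (proj₂ T∈)) } }
    ; injective = λ { {node _ _} {node _ _} T∈ T′∈ refl →
        case root≡0 T∈ , root≡0 T′∈ of λ { (refl , refl) → refl } }
    ; surjective = λ { (wi ∷ [] , labels↭M) →
        node 0 _ , (wi , prep 0 (↭-trans (↭-reflexive (sym (++-identityʳ _))) labels↭M)) , refl } }
  defect-children : ∀ {T} → TreesOf M T → groveDefect (children T ∷ []) ≡ defect T
  defect-children {node a cs} _ = trans (ℤP.+-identityʳ (rootedDefect cs)) (sym (defect-node a cs))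

proposition2p7 : (n : ℕ) (p : Fin n → ℕ) → (∀ i → 0 < p i) →
    (ts : List Tree) → Unique ts → (∀ T → (T ∈ ts) ⇔ InTM n p T) →
    sum (map oddFullDegreeNodes ts) ≡ 2 * sum (map oddDegreeNodes ts)
proposition2p7 n p _ ts ts! ts⇔TM =
  surplus≡0⇒a≡2*b (sum (map oddFullDegreeNodes ts)) (sum (map oddDegreeNodes ts)) (begin
    surplus (sum (map oddFullDegreeNodes ts)) (sum (map oddDegreeNodes ts))
      ≡⟨ sumℤ-surplus oddFullDegreeNodes oddDegreeNodes ts ⟨
    sumℤ (map defect ts)
      ≡⟨ zeroSum-trees (multisetList n p) ts (ts! , ts⇔TM) ⟩
    0ℤ ∎)
  where open ≡-Reasoning
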